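{- For every positive integer $N$, the set $\{n^3: n\in\mathbb{Z},\ N\leq n\leq N+(0.5N)^{1/3}\}$ is a Sidon set.
   Context: A set $A\subseteq\mathbb{Z}$ is a Sidon set if the only solutions of $a_1+b_1=a_2+b_2$ with $a_1,b_1,a_2,b_2\in A$ are the trivial ones, i.e. those with $\{a_1,b_1\}=\{a_2,b_2\}$. -}

module Defs where

open import Data.Integer using (ℤ; +_; _+_; _-_; _*_; _≤_; _^_)
open import Data.Product using (_×_; ∃-syntax)
open import Data.Sum using (_⊎_)
open import Relation.Binary.PropositionalEquality using (_≡_)

IsSidon : (ℤ → Set) → Set
IsSidon A = ∀ a₁ b₁ a₂ b₂ → A a₁ → A b₁ → A a₂ → A b₂ →
  a₁ + b₁ ≡ a₂ + b₂ →
  (a₁ ≡ a₂ × b₁ ≡ b₂) ⊎ (a₁ ≡ b₂ × b₁ ≡ a₂)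

-- The set { n^3 : n ∈ ℤ, N ≤ n ≤ N + (N/2)^(1/3) }.
-- For N ≤ n, the condition n ≤ N + (0.5 N)^(1/3) is equivalent
-- (monotonicity of cubing on nonnegative reals) to 2 (n - N)^3 ≤ N.
CubeBlock : ℤ → ℤ → Set
CubeBlock N x = ∃[ n ] (N ≤ n × (+ 2) * ((n - N) ^ 3) ≤ N × x ≡ n ^ 3)

-- Write the elements as (N + x)³ with 0 ≤ x and 2x³ ≤ N.  A coincidence
-- (N + x₁)³ + (N + x₂)³ = (N + x₃)³ + (N + x₄)³ expands to 3N((N + 1)P + Q) + R = 0, where
-- P, Q and R compare the pair sums of x, x(x − 1) and x³.  Each of these pair differences is
-- at most N in absolute value, so |R| < 3N forces (N + 1)P + Q = 0, and then |Q| < N + 1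
-- forces P = Q = 0.  The pairs {x₁, x₂} and {x₃, x₄} thus have equal sums and equal sums of
-- squares, hence coincide.  (Splitting x² = x(x − 1) + x is what makes the second bound strict.)
module Submission where

open import Defs
open import Data.Nat using (ℕ; NonZero; suc; z≤n; s≤s)
open import Data.Integer
  using (ℤ; +_; +[1+_]; -[1+_]; 0ℤ; 1ℤ; _+_; _-_; -_; _*_; _^_; _≤_; _<_; +≤+; +<+; positive)
open import Data.Integer.Properties
open import Data.Integer.Tactic.RingSolver using (solve-∀)
open import Algebra.Properties.AbelianGroup +-0-abelianGroup using (∙-cancelˡ)
open import Data.Product using (_×_; _,_; ∃-syntax)
open import Data.Sum using (_⊎_; inj₁; inj₂)
open import Function using (id)
open import Relation.Binary.PropositionalEquality
open import Relation.Nullary using (contradiction)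

SamePair : ℤ → ℤ → ℤ → ℤ → Set
SamePair a b c d = (a ≡ c × b ≡ d) ⊎ (a ≡ d × b ≡ c)

SamePair-map : ∀ (f : ℤ → ℤ) {a b c d} → SamePair a b c d → SamePair (f a) (f b) (f c) (f d)
SamePair-map f (inj₁ (a≡c , b≡d)) = inj₁ (cong f a≡c , cong f b≡d)
SamePair-map f (inj₂ (a≡d , b≡c)) = inj₂ (cong f a≡d , cong f b≡c)

pairDiff : (ℤ → ℤ) → ℤ → ℤ → ℤ → ℤ → ℤ
pairDiff f a b c d = (f a + f b) - (f c + f d)

pairDiff≡0⇒sums≡ : ∀ f a b c d → pairDiff f a b c d ≡ 0ℤ → f a + f b ≡ f c + f d
pairDiff≡0⇒sums≡ f a b c d = i-j≡0⇒i≡j _ _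

+≡∧squares≡⇒SamePair : ∀ {a b c d} → a + b ≡ c + d → a * a + b * b ≡ c * c + d * d →
                        SamePair a b c d
+≡∧squares≡⇒SamePair {a} {b} {c} {d} sums squares
  with i*j≡0⇒i≡0∨j≡0 (a - c) (*-cancelˡ-≡ (+ 2) _ 0ℤ twice≡0)
  where
  identity : ∀ a b c d → + 2 * ((a - c) * (a - d)) ≡
    (a * a + b * b - (c * c + d * d)) + (a + b - (c + d)) * (a + b - (c + d) - + 2 * b)
  identity = solve-∀
  twice≡0 : + 2 * ((a - c) * (a - d)) ≡ + 2 * 0ℤ
  twice≡0 = begin
    + 2 * ((a - c) * (a - d))                                      ≡⟨ identity a b c d ⟩
    (a * a + b * b - (c * c + d * d)) + (a + b - (c + d)) * (a + b - (c + d) - + 2 * b)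
      ≡⟨ cong₂ (λ q p → q + p * (p - + 2 * b)) (i≡j⇒i-j≡0 squares) (i≡j⇒i-j≡0 sums) ⟩
    0ℤ + 0ℤ * (0ℤ - + 2 * b)                                        ≡⟨⟩
    + 2 * 0ℤ                                                       ∎
    where open ≡-Reasoning
... | inj₁ a-c≡0 = inj₁ (a≡c , ∙-cancelˡ a b d (trans sums (cong (_+ d) (sym a≡c))))
  where a≡c = i-j≡0⇒i≡j a c a-c≡0
... | inj₂ a-d≡0 = inj₂ (a≡d , ∙-cancelˡ a b c (trans sums (trans (+-comm c d) (cong (_+ c) (sym a≡d)))))
  where a≡d = i-j≡0⇒i≡j a d a-d≡0

0<k*m+r : ∀ k {m r} → 1ℤ ≤ m → - + k < r → 0ℤ < + k * m + r
0<k*m+r k {m} {r} 1≤m -k<r = begin-strict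
  0ℤ         ≡⟨ sym (+-inverseʳ (+ k)) ⟩
  + k - + k  <⟨ +-mono-≤-< k≤k*m -k<r ⟩
  + k * m + r ∎
  where
  open ≤-Reasoning
  k≤k*m : + k ≤ + k * m
  k≤k*m = subst (_≤ + k * m) (*-identityʳ (+ k)) (*-monoˡ-≤-nonNeg (+ k) 1≤m)

k*m+r≡0⇒m≡0 : ∀ k {m r} → - k < r → r < k → k * m + r ≡ 0ℤ → m ≡ 0ℤ
k*m+r≡0⇒m≡0 -[1+ _ ] -k<r r<k _ with () ← <-trans -k<r r<k
k*m+r≡0⇒m≡0 (+ k) {+ 0} _ _ _ = refl
k*m+r≡0⇒m≡0 (+ k) {+[1+ j ]} -k<r _ eq =
  contradiction (sym eq) (<⇒≢ (0<k*m+r k (+≤+ (s≤s z≤n)) -k<r))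
k*m+r≡0⇒m≡0 (+ k) { -[1+ j ]} {r} _ r<k eq =
  contradiction (sym (trans (negated (+ k) -[1+ j ] r) (cong -_ eq)))
                (<⇒≢ (0<k*m+r k (+≤+ (s≤s z≤n)) (neg-mono-< r<k)))
  where
  negated : ∀ k m r → k * (- m) + - r ≡ - (k * m + r)
  negated = solve-∀

HalfBounded : ℤ → ℤ → Set
HalfBounded N a = 0ℤ ≤ a × + 2 * a ≤ N

halfBounded⇒+≤ : ∀ {N a b} → HalfBounded N a → HalfBounded N b → a + b ≤ N
halfBounded⇒+≤ {N} {a} {b} (_ , 2a≤N) (_ , 2b≤N) = *-cancelˡ-≤-pos (a + b) N (+ 2) (begin
  + 2 * (a + b)     ≡⟨ *-distribˡ-+ (+ 2) a b ⟩
  + 2 * a + + 2 * b ≤⟨ +-mono-≤ 2a≤N 2b≤N ⟩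
  N + N             ≡⟨ doubling N ⟩
  + 2 * N           ∎)
  where
  open ≤-Reasoning
  doubling : ∀ N → N + N ≡ + 2 * N
  doubling = solve-∀

difference-bounded : ∀ {N u v} → 0ℤ ≤ u → u ≤ N → 0ℤ ≤ v → v ≤ N → - N ≤ u - v × u - v ≤ N
difference-bounded {N} {u} {v} 0≤u u≤N 0≤v v≤N =
    subst (_≤ u - v) (+-identityˡ (- N)) (+-mono-≤ 0≤u (neg-mono-≤ v≤N))
  , subst (u - v ≤_) (+-identityʳ N) (+-mono-≤ u≤N (neg-mono-≤ 0≤v))

pairDiff-bounded : ∀ {N} f a b c d →
  HalfBounded N (f a) → HalfBounded N (f b) → HalfBounded N (f c) → HalfBounded N (f d) →
  - N ≤ pairDiff f a b c d × pairDiff f a b c d ≤ N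
pairDiff-bounded f _ _ _ _ ha@(0≤a , _) hb@(0≤b , _) hc@(0≤c , _) hd@(0≤d , _) =
  difference-bounded (+-mono-≤ 0≤a 0≤b) (halfBounded⇒+≤ ha hb) (+-mono-≤ 0≤c 0≤d) (halfBounded⇒+≤ hc hd)

0≤i*j : ∀ {i j} → 0ℤ ≤ i → 0ℤ ≤ j → 0ℤ ≤ i * j
0≤i*j (+≤+ {n = m} _) (+≤+ {n = n} _) = subst (0ℤ ≤_) (pos-* m n) (+≤+ z≤n)

0≤i*[i-1] : ∀ {i} → 0ℤ ≤ i → 0ℤ ≤ i * (i - 1ℤ)
0≤i*[i-1] {+ 0}      _ = +≤+ z≤n
0≤i*[i-1] {+[1+ n ]} _ = 0≤i*j {+[1+ n ]} {+ n} (+≤+ z≤n) (+≤+ z≤n)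

i*[i-1]≤i^3 : ∀ {i} → 0ℤ ≤ i → i * (i - 1ℤ) ≤ i ^ 3
i*[i-1]≤i^3 {i} 0≤i = 0≤i-j⇒j≤i (subst (0ℤ ≤_) (sym (factorisation i))
  (0≤i*j 0≤i (+-mono-≤ (0≤i*[i-1] 0≤i) (+≤+ z≤n))))
  where
  factorisation : ∀ i → i * (i * (i * 1ℤ)) - i * (i - 1ℤ) ≡ i * (i * (i - 1ℤ) + 1ℤ)
  factorisation = solve-∀

SmallOffset : ℤ → ℤ → Set
SmallOffset N x = 0ℤ ≤ x × + 2 * x ^ 3 ≤ N

smallOffset⇒halfBounded-x^3 : ∀ {N x} → SmallOffset N x → HalfBounded N (x ^ 3)
smallOffset⇒halfBounded-x^3 (0≤x , 2x³≤N) = 0≤i*j 0≤x (0≤i*j 0≤x (0≤i*j 0≤x (+≤+ z≤n))) , 2x³≤N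

smallOffset⇒halfBounded-x*[x-1] : ∀ {N x} → SmallOffset N x → HalfBounded N (x * (x - 1ℤ))
smallOffset⇒halfBounded-x*[x-1] (0≤x , 2x³≤N) =
  0≤i*[i-1] 0≤x , ≤-trans (*-monoˡ-≤-nonNeg (+ 2) (i*[i-1]≤i^3 0≤x)) 2x³≤N

cubeBlock⇒smallOffset : ∀ {N a} → CubeBlock N a → ∃[ x ] (SmallOffset N x × a ≡ (x + N) ^ 3)
cubeBlock⇒smallOffset {N} (n , N≤n , 2[n-N]³≤N , a≡n³) =
  n - N , (i≤j⇒0≤j-i N≤n , 2[n-N]³≤N) , trans a≡n³ (cong (_^ 3) (shift n N))
  where
  shift : ∀ n N → n ≡ n - N + N
  shift = solve-∀

pairDiff-shiftedCube : ∀ N a b c d → pairDiff (λ x → (x + N) ^ 3) a b c d ≡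
  + 3 * N * ((N + 1ℤ) * pairDiff id a b c d + pairDiff (λ x → x * (x - 1ℤ)) a b c d)
  + pairDiff (_^ 3) a b c d
pairDiff-shiftedCube = expansion
  where
  -- The ring solver does not handle _^_, so cubes are written as their unfolding.
  expansion : ∀ N a b c d →
    ((a + N) * ((a + N) * ((a + N) * 1ℤ)) + (b + N) * ((b + N) * ((b + N) * 1ℤ)))
      - ((c + N) * ((c + N) * ((c + N) * 1ℤ)) + (d + N) * ((d + N) * ((d + N) * 1ℤ))) ≡
    + 3 * N * ((N + 1ℤ) * ((a + b) - (c + d))
               + ((a * (a - 1ℤ) + b * (b - 1ℤ)) - (c * (c - 1ℤ) + d * (d - 1ℤ))))
    + ((a * (a * (a * 1ℤ)) + b * (b * (b * 1ℤ))) - (c * (c * (c * 1ℤ)) + d * (d * (d * 1ℤ))))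
  expansion = solve-∀

bounded⇒strictlyBounded : ∀ {N k r} → - N ≤ r × r ≤ N → N < k → - k < r × r < k
bounded⇒strictlyBounded (-N≤r , r≤N) N<k = <-≤-trans (neg-mono-< N<k) -N≤r , ≤-<-trans r≤N N<k

shiftedCubes-SamePair : ∀ {N x₁ x₂ x₃ x₄} → 0ℤ < N →
  SmallOffset N x₁ → SmallOffset N x₂ → SmallOffset N x₃ → SmallOffset N x₄ →
  (x₁ + N) ^ 3 + (x₂ + N) ^ 3 ≡ (x₃ + N) ^ 3 + (x₄ + N) ^ 3 → SamePair x₁ x₂ x₃ x₄
shiftedCubes-SamePair {N} {x₁} {x₂} {x₃} {x₄} 0<N s₁ s₂ s₃ s₄ eq =
  +≡∧squares≡⇒SamePair
    (pairDiff≡0⇒sums≡ id x₁ x₂ x₃ x₄ P≡0)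
    (pairDiff≡0⇒sums≡ (λ x → x * x) x₁ x₂ x₃ x₄ (trans (squares x₁ x₂ x₃ x₄) (cong₂ _+_ Q≡0 P≡0)))
  where
  P Q R : ℤ
  P = pairDiff id x₁ x₂ x₃ x₄
  Q = pairDiff (λ x → x * (x - 1ℤ)) x₁ x₂ x₃ x₄
  R = pairDiff (_^ 3) x₁ x₂ x₃ x₄
  squares : ∀ a b c d → (a * a + b * b) - (c * c + d * d) ≡
    ((a * (a - 1ℤ) + b * (b - 1ℤ)) - (c * (c - 1ℤ) + d * (d - 1ℤ))) + ((a + b) - (c + d))
  squares = solve-∀
  N<3N : N < + 3 * N
  N<3N = subst (_< + 3 * N) (*-identityˡ N)
                (*-monoʳ-<-pos N {{positive 0<N}} {1ℤ} {+ 3} (+<+ (s≤s (s≤s z≤n))))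
  N<N+1 : N < N + 1ℤ
  N<N+1 = subst (_< N + 1ℤ) (+-identityʳ N) (+-monoʳ-< N (+<+ (s≤s z≤n)))
  R-bounded : - N ≤ R × R ≤ N
  R-bounded = pairDiff-bounded (_^ 3) x₁ x₂ x₃ x₄
    (smallOffset⇒halfBounded-x^3 s₁) (smallOffset⇒halfBounded-x^3 s₂)
    (smallOffset⇒halfBounded-x^3 s₃) (smallOffset⇒halfBounded-x^3 s₄)
  Q-bounded : - N ≤ Q × Q ≤ N
  Q-bounded = pairDiff-bounded (λ x → x * (x - 1ℤ)) x₁ x₂ x₃ x₄
    (smallOffset⇒halfBounded-x*[x-1] s₁) (smallOffset⇒halfBounded-x*[x-1] s₂)
    (smallOffset⇒halfBounded-x*[x-1] s₃) (smallOffset⇒halfBounded-x*[x-1] s₄)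
  M≡0 : (N + 1ℤ) * P + Q ≡ 0ℤ
  M≡0 with -3N<R , R<3N ← bounded⇒strictlyBounded R-bounded N<3N
    = k*m+r≡0⇒m≡0 (+ 3 * N) -3N<R R<3N
        (trans (sym (pairDiff-shiftedCube N x₁ x₂ x₃ x₄)) (i≡j⇒i-j≡0 eq))
  P≡0 : P ≡ 0ℤ
  P≡0 with -N-1<Q , Q<N+1 ← bounded⇒strictlyBounded Q-bounded N<N+1
    = k*m+r≡0⇒m≡0 (N + 1ℤ) -N-1<Q Q<N+1 M≡0
  Q≡0 : Q ≡ 0ℤ
  Q≡0 = begin
    Q                    ≡⟨ sym (+-identityˡ Q) ⟩
    0ℤ + Q               ≡⟨ cong (_+ Q) (sym (*-zeroʳ (N + 1ℤ))) ⟩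
    (N + 1ℤ) * 0ℤ + Q    ≡⟨ cong (λ p → (N + 1ℤ) * p + Q) (sym P≡0) ⟩
    (N + 1ℤ) * P + Q     ≡⟨ M≡0 ⟩
    0ℤ                   ∎
    where open ≡-Reasoning

proposition5p2 : (N : ℕ) → .{{_ : NonZero N}} → IsSidon (CubeBlock (+ N))
proposition5p2 N@(suc _) _ _ _ _ A₁ B₁ A₂ B₂ eq
  with x₁ , s₁ , refl ← cubeBlock⇒smallOffset A₁
     | y₁ , t₁ , refl ← cubeBlock⇒smallOffset B₁
     | x₂ , s₂ , refl ← cubeBlock⇒smallOffset A₂
     | y₂ , t₂ , refl ← cubeBlock⇒smallOffset B₂
  = SamePair-map (λ x → (x + + N) ^ 3) (shiftedCubes-SamePair (+<+ (s≤s z≤n)) s₁ t₁ s₂ t₂ eq)
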